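{- Let $G$ be a connected graph. The following are equivalent: (1) $G$ has no choke points; (2) $G$ satisfies the pairwise edge-disjoint path property; (3) $G$ is a tree or a cycle.
   Context: A path has no repeated vertices; $\mathcal{P}(u,v)$ is the set of paths from $u$ to $v$ in $G$. $G$ has the pairwise edge-disjoint path property if for any distinct vertices $u,v$ and any two distinct $u,v$-paths $P_1,P_2$, $E(P_1)\cap E(P_2)=\emptyset$. A star $S_k$ is a tree on $k+1$ vertices consisting of one vertex (the internal vertex) adjacent to all $k$ others. For $u,v\in V(G)$, let $F=\bigcup_{P\in\mathcal{P}(u,v)}P$ (the subgraph consisting of all vertices and edges of $u,v$-paths); if $F$ contains a star $S_k$ with $k\ge 3$ as a subgraph, its internal vertex is called a choke point of $u$ and $v$. $G$ has a choke point if some vertex is a choke point of some pair $u,v$. -}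

module Defs where

open import Data.Nat using (ℕ; zero; suc; _≤_)
open import Data.Fin using (Fin; toℕ)
open import Data.Bool using (Bool; true; false; T)
open import Data.List using (List; []; _∷_; head; last)
open import Data.List.Relation.Unary.Unique.Propositional using (Unique)
open import Data.Maybe using (just)
open import Data.Product using (Σ; ∃; ∃-syntax; _×_)
open import Data.Sum using (_⊎_)
open import Data.Unit using (⊤)
open import Relation.Nullary using (¬_)
open import Relation.Binary.PropositionalEquality using (_≡_; _≢_)
open import Function.Definitions using (Injective; Bijective)
open import Function.Bundles using (_⇔_)

record Graph : Set where
  field
    n      : ℕ
    adj    : Fin n → Fin n → Bool
    sym    : ∀ x y → adj x y ≡ adj y x
    irrefl : ∀ x → adj x x ≡ false

module _ (G : Graph) where
  open Graph G

  V : Set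
  V = Fin n

  _~_ : V → V → Set
  x ~ y = T (adj x y)

  Chain : List V → Set
  Chain []           = ⊤
  Chain (x ∷ [])     = ⊤
  Chain (x ∷ y ∷ xs) = (x ~ y) × Chain (y ∷ xs)

  IsPath : V → V → List V → Set
  IsPath u v p = (head p ≡ just u) × (last p ≡ just v) × Unique p × Chain p

  -- connected (and nonempty): every two vertices are joined by a path
  Connected : Set
  Connected = Fin n × (∀ u v → ∃[ p ] IsPath u v p)

  data Consec (x y : V) : List V → Set where
    here  : ∀ {xs} → Consec x y (x ∷ y ∷ xs)
    there : ∀ {z xs} → Consec x y xs → Consec x y (z ∷ xs)

  EdgeOf : V → V → List V → Set
  EdgeOf x y p = Consec x y p ⊎ Consec y x p

  PEDP : Set
  PEDP = ∀ u v → u ≢ v → ∀ p₁ p₂ → IsPath u v p₁ → IsPath u v p₂ → p₁ ≢ p₂ →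
         ∀ x y → ¬ (EdgeOf x y p₁ × EdgeOf x y p₂)

  -- the edge {x,y} belongs to F = union of all u,v-paths
  EdgeInF : V → V → V → V → Set
  EdgeInF u v x y = ∃[ p ] (IsPath u v p × EdgeOf x y p)

  -- c is a choke point of u and v: F contains a star S_k (k ≥ 3) with
  -- internal vertex c, i.e. k distinct leaves, all different from c,
  -- each joined to c by an edge of F
  ChokePointOf : V → V → V → Set
  ChokePointOf u v c =
    ∃[ k ] (3 ≤ k × Σ (Fin k → V) λ leaf →
      Injective _≡_ _≡_ leaf × (∀ i → leaf i ≢ c) × (∀ i → EdgeInF u v c (leaf i)))

  HasChokePoint : Set
  HasChokePoint = ∃[ u ] ∃[ v ] ∃[ c ] ChokePointOf u v c

  HasCycle : Set
  HasCycle = ∃[ x ] ∃[ y ] ∃[ z ] ∃[ rest ]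
    (Unique (x ∷ y ∷ z ∷ rest) × Chain (x ∷ y ∷ z ∷ rest) ×
     Σ V λ w → (last (z ∷ rest) ≡ just w) × (w ~ x))

  IsTree : Set
  IsTree = Connected × ¬ HasCycle

CycleEdge : (m : ℕ) → Fin m → Fin m → Set
CycleEdge m i j = (suc (toℕ i) ≡ toℕ j) ⊎ ((suc (toℕ i) ≡ m) × (toℕ j ≡ 0))

CycAdj : (m : ℕ) → Fin m → Fin m → Set
CycAdj m i j = CycleEdge m i j ⊎ CycleEdge m j i

IsCycle : Graph → Set
IsCycle G = 3 ≤ n × Σ (Fin n → Fin n) λ σ →
  Bijective _≡_ _≡_ σ × (∀ i j → (T (adj (σ i) (σ j)) ⇔ CycAdj n i j))
  where open Graph G

{-# OPTIONS --safe #-}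
module Submission where

-- Two distinct u–v paths through a common edge can be followed along that edge until they
-- part; at the parting vertex the two paths together contribute three edges, a choke point.
-- In a tree all u–v paths coincide (two different ones would close a cycle), and in a cycle
-- every vertex has degree two, so neither has a choke point.  Conversely, let G satisfy the
-- path property.  An edge from a vertex c of a cycle C to a vertex w other than the two
-- neighbours of c on C would give two paths ending with the same edge at c: a short one and
-- one running around C.  So C is closed under adjacency, hence all of G, and G ≅ C_n; if G
-- has no cycle it is a tree.

open import Defs
open import Data.Bool using (T; T?)
open import Data.Empty using (⊥; ⊥-elim)
open import Data.Fin using (Fin; zero; suc; toℕ; _≟_)
open import Data.Fin.Permutation using (↔⇒≡)
open import Data.Fin.Properties using (toℕ-injective; toℕ<n; injective⇒≤; any?)
open import Data.List using (List; []; _∷_; _++_; _∷ʳ_; [_]; head; last; length; lookup; reverse)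
open import Data.List.Membership.Propositional using (_∈_; _∉_)
open import Data.List.Membership.Propositional.Properties
  using (∈-∃++; ∈-++⁺ˡ; ∈-++⁺ʳ; ∈-++⁻; ∈-lookup)
open import Data.List.Properties
  using (++-assoc; ++-identityˡ-unique; unfold-reverse; reverse-++; reverse-involutive; reverse-injective;
         ∷-injectiveʳ; ≡-dec)
open import Data.List.Relation.Binary.Permutation.Propositional using (↭-sym; ↭⇒↭ₛ)
open import Data.List.Relation.Binary.Permutation.Propositional.Properties
  using (↭-reverse; ++-comm; ↭-length)
open import Data.List.Relation.Binary.Permutation.Setoid.Properties using (Unique-resp-↭)
open import Data.List.Relation.Unary.All as All using (All; []; _∷_)
open import Data.List.Relation.Unary.All.Properties using (¬Any⇒All¬)
open import Data.List.Relation.Unary.AllPairs using ([]; _∷_)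
open import Data.List.Relation.Unary.Any using (here; there; index)
open import Data.List.Relation.Unary.Any.Properties using (lookup-index; reverse⁻)
open import Data.List.Relation.Unary.Unique.Propositional using (Unique)
open import Data.List.Relation.Unary.Unique.Propositional.Properties using (++⁺; Unique[x∷xs]⇒x∉xs)
open import Data.Maybe using (just)
open import Data.Maybe.Properties as Maybe using (just-injective)
open import Data.Nat as ℕ using (ℕ; suc; s≤s; z≤n; _≤_)
open import Data.Nat.Properties using (≤-refl; suc-injective; <-irrefl)
open import Data.Product using (_×_; _,_; proj₁; proj₂; Σ; ∃; ∃₂)
open import Data.Sum as Sum using (_⊎_; inj₁; inj₂)
open import Data.Sum.Function.Propositional using (_⊎-⇔_)
open import Data.Unit using (tt)
open import Function using (_∘_)
open import Function.Bundles using (_⇔_; mk⇔; Equivalence; mk⤖)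
open import Function.Construct.Composition using (_⇔-∘_)
open import Function.Definitions using (Bijective)
open import Function.Properties.Bijection using (⤖⇒↔)
open import Relation.Binary.PropositionalEquality
  using (_≡_; _≢_; ≢-sym; refl; sym; trans; cong; subst; subst₂; setoid; module ≡-Reasoning)
open import Relation.Nullary using (¬_; Dec; yes; no; contradiction)
open import Relation.Nullary.Decidable using (decidable-stable; map′; _×-dec_; _⊎-dec_)

private variable
  A : Set
  p : A
  xs ys : List A

last-++-∷ : ∀ (xs : List A) y ys → last (xs ++ y ∷ ys) ≡ last (y ∷ ys)
last-++-∷ []            y ys = refl
last-++-∷ (x ∷ [])      y ys = refl
last-++-∷ (x ∷ x′ ∷ xs) y ys = last-++-∷ (x′ ∷ xs) y ys

last-∷ʳ : ∀ (xs : List A) y → last (xs ∷ʳ y) ≡ just y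
last-∷ʳ xs y = last-++-∷ xs y []

last-∷ : ∀ (x : A) xs → ∃ λ y → last (x ∷ xs) ≡ just y
last-∷ x []       = x , refl
last-∷ _ (x ∷ xs) = last-∷ x xs

head-++-∷ : ∀ (xs : List A) y ys zs → head (xs ++ y ∷ ys) ≡ head (xs ++ y ∷ zs)
head-++-∷ []      _ _ _ = refl
head-++-∷ (_ ∷ _) _ _ _ = refl

last⇒∈ : last xs ≡ just p → p ∈ xs
last⇒∈ {xs = x ∷ []}      refl = here refl
last⇒∈ {xs = x ∷ x′ ∷ xs} eq   = there (last⇒∈ {xs = x′ ∷ xs} eq)

head⇒∈ : head xs ≡ just p → p ∈ xs
head⇒∈ {xs = x ∷ xs} refl = here refl

head≢last⇒2≤length : head xs ≢ last xs → 2 ≤ length xs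
head≢last⇒2≤length {xs = []}        h≢l = ⊥-elim (h≢l refl)
head≢last⇒2≤length {xs = _ ∷ []}    h≢l = ⊥-elim (h≢l refl)
head≢last⇒2≤length {xs = _ ∷ _ ∷ _} _   = s≤s (s≤s z≤n)

last-reverse : ∀ (xs : List A) → last (reverse xs) ≡ head xs
last-reverse []       = refl
last-reverse (x ∷ xs) = trans (cong last (unfold-reverse x xs)) (last-∷ʳ (reverse xs) x)

head-reverse : ∀ (xs : List A) → head (reverse xs) ≡ last xs
head-reverse xs = trans (sym (last-reverse (reverse xs))) (cong last (reverse-involutive xs))

reverse-++-∷-∷ : ∀ (xs : List A) x y ys →
                 reverse (xs ++ x ∷ y ∷ ys) ≡ reverse ys ++ y ∷ x ∷ reverse xs
reverse-++-∷-∷ xs x y ys = begin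
  reverse (xs ++ x ∷ y ∷ ys)              ≡⟨ reverse-++ xs (x ∷ y ∷ ys) ⟩
  reverse (x ∷ y ∷ ys) ++ reverse xs      ≡⟨ cong (_++ reverse xs) (unfold-reverse x (y ∷ ys)) ⟩
  (reverse (y ∷ ys) ∷ʳ x) ++ reverse xs   ≡⟨ cong (λ l → (l ∷ʳ x) ++ reverse xs) (unfold-reverse y ys) ⟩
  ((reverse ys ∷ʳ y) ∷ʳ x) ++ reverse xs  ≡⟨ ++-assoc (reverse ys ∷ʳ y) [ x ] (reverse xs) ⟩
  (reverse ys ∷ʳ y) ++ x ∷ reverse xs     ≡⟨ ++-assoc (reverse ys) [ y ] (x ∷ reverse xs) ⟩
  reverse ys ++ y ∷ x ∷ reverse xs        ∎
  where open ≡-Reasoning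

∷-reverse : ∀ (xs : List A) x → x ∷ reverse xs ≡ reverse (xs ∷ʳ x)
∷-reverse xs x = sym (reverse-++ xs [ x ])

last-∷-reverse : ∀ (xs : List A) x ys → last (x ∷ reverse xs) ≡ head (xs ++ x ∷ ys)
last-∷-reverse xs x ys = begin
  last (x ∷ reverse xs)     ≡⟨ cong last (∷-reverse xs x) ⟩
  last (reverse (xs ∷ʳ x))  ≡⟨ last-reverse (xs ∷ʳ x) ⟩
  head (xs ∷ʳ x)            ≡⟨ head-++-∷ xs x [] ys ⟩
  head (xs ++ x ∷ ys)       ∎
  where open ≡-Reasoning

∈-∷-reverse : ∀ {xs : List A} {x ys} → p ∈ x ∷ reverse xs → p ∈ xs ++ x ∷ ys
∈-∷-reverse {xs = xs} (here refl) = ∈-++⁺ʳ xs (here refl)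
∈-∷-reverse {xs = xs} (there p∈)  = ∈-++⁺ˡ (reverse⁻ {xs = xs} p∈)

Unique-reverse : Unique xs → Unique (reverse xs)
Unique-reverse {xs = xs} = Unique-resp-↭ (setoid _) (↭⇒↭ₛ (↭-sym (↭-reverse xs)))

Unique-++-comm : ∀ (xs : List A) {ys} → Unique (xs ++ ys) → Unique (ys ++ xs)
Unique-++-comm xs {ys} = Unique-resp-↭ (setoid _) (↭⇒↭ₛ (++-comm xs ys))

Unique-++⁻ʳ : ∀ (xs : List A) → Unique (xs ++ ys) → Unique ys
Unique-++⁻ʳ []       uniq       = uniq
Unique-++⁻ʳ (x ∷ xs) (_ ∷ uniq) = Unique-++⁻ʳ xs uniq

Unique-++⁻ˡ : ∀ (xs : List A) → Unique (xs ++ ys) → Unique xs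
Unique-++⁻ˡ {ys = ys} xs uniq = Unique-++⁻ʳ ys (Unique-++-comm xs uniq)

Unique-++-disjoint : ∀ (xs : List A) → Unique (xs ++ ys) → p ∈ xs → p ∉ ys
Unique-++-disjoint (x ∷ xs) uniq       (here refl) p∈ys = Unique[x∷xs]⇒x∉xs uniq (∈-++⁺ʳ xs p∈ys)
Unique-++-disjoint (x ∷ xs) (_ ∷ uniq) (there p∈xs)     = Unique-++-disjoint xs uniq p∈xs

Unique-∷-reverse : ∀ (xs : List A) {x ys} → Unique (xs ++ x ∷ ys) → Unique (x ∷ reverse xs)
Unique-∷-reverse xs {x} uniq = subst Unique (sym (∷-reverse xs x))
  (Unique-reverse (Unique-++⁻ˡ (xs ∷ʳ x) (subst Unique (sym (++-assoc xs [ x ] _)) uniq)))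

lookup-injective : Unique xs → ∀ {i j} → lookup xs i ≡ lookup xs j → i ≡ j
lookup-injective {xs = x ∷ xs} _ {zero}  {zero}  _ = refl
lookup-injective {xs = x ∷ xs} uniq {zero} {suc j} eq =
  ⊥-elim (Unique[x∷xs]⇒x∉xs uniq (subst (_∈ xs) (sym eq) (∈-lookup j)))
lookup-injective {xs = x ∷ xs} uniq {suc i} {zero} eq =
  ⊥-elim (Unique[x∷xs]⇒x∉xs uniq (subst (_∈ xs) eq (∈-lookup i)))
lookup-injective {xs = x ∷ xs} (_ ∷ uniq) {suc i} {suc j} eq = cong suc (lookup-injective uniq eq)

last⇒lookup : last xs ≡ just p → ∃ λ i → lookup xs i ≡ p × suc (toℕ i) ≡ length xs
last⇒lookup {xs = _ ∷ []}     refl = zero , refl , refl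
last⇒lookup {xs = _ ∷ x ∷ xs} eq with i , eqi , len ← last⇒lookup {xs = x ∷ xs} eq =
  suc i , eqi , cong suc len

lookup⇒last : ∀ (xs : List A) {i} → suc (toℕ i) ≡ length xs → last xs ≡ just (lookup xs i)
lookup⇒last (_ ∷ [])     {zero}  _  = refl
lookup⇒last (_ ∷ x ∷ xs) {suc i} eq = lookup⇒last (x ∷ xs) (suc-injective eq)

lookup⇒head : ∀ (xs : List A) {i} → toℕ i ≡ 0 → head xs ≡ just (lookup xs i)
lookup⇒head (_ ∷ _) {zero} _ = refl

head⇒lookup : Unique xs → ∀ {i} → head xs ≡ just (lookup xs i) → toℕ i ≡ 0
head⇒lookup {xs = _ ∷ _} uniq eq = cong toℕ (sym (lookup-injective uniq {zero} (just-injective eq)))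

∃≤ : ℕ → (List A → Set) → Set
∃≤ k P = ∃ λ xs → length xs ≤ k × P xs

∃≤? : ∀ {m} (P : List (Fin m) → Set) → (∀ xs → Dec (P xs)) → ∀ k → Dec (∃≤ k P)
∃≤? P P? ℕ.zero  = map′ (λ p → [] , z≤n , p) (λ { ([] , _ , p) → p }) (P? [])
∃≤? P P? (suc k) =
  map′ fromCases toCases (P? [] ⊎-dec any? λ x → ∃≤? (P ∘ (x ∷_)) (P? ∘ (x ∷_)) k)
  where
  fromCases : P [] ⊎ ∃ (λ x → ∃≤ k (P ∘ (x ∷_))) → ∃≤ (suc k) P
  fromCases (inj₁ p)                  = [] , z≤n , p
  fromCases (inj₂ (x , xs , len , p)) = x ∷ xs , s≤s len , p
  toCases : ∃≤ (suc k) P → P [] ⊎ ∃ (λ x → ∃≤ k (P ∘ (x ∷_)))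
  toCases ([]     , _       , p) = inj₁ p
  toCases (x ∷ xs , s≤s len , p) = inj₂ (x , xs , len , p)

AtMostOne : (A → Set) → Set
AtMostOne P = ∀ {a b} → P a → P b → a ≡ b

AtMostTwo : (A → Set) → Set
AtMostTwo P = ∀ {a b d} → P a → P b → P d → a ≡ b ⊎ a ≡ d ⊎ b ≡ d

atMostTwo-⊎ : {P Q : A → Set} → AtMostOne P → AtMostOne Q → AtMostTwo (λ a → P a ⊎ Q a)
atMostTwo-⊎ P! Q! (inj₁ pa) (inj₁ pb) _         = inj₁ (P! pa pb)
atMostTwo-⊎ P! Q! (inj₂ qa) (inj₂ qb) _         = inj₁ (Q! qa qb)
atMostTwo-⊎ P! Q! (inj₁ pa) (inj₂ _)  (inj₁ pd) = inj₂ (inj₁ (P! pa pd))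
atMostTwo-⊎ P! Q! (inj₁ _)  (inj₂ qb) (inj₂ qd) = inj₂ (inj₂ (Q! qb qd))
atMostTwo-⊎ P! Q! (inj₂ _)  (inj₁ pb) (inj₁ pd) = inj₂ (inj₂ (P! pb pd))
atMostTwo-⊎ P! Q! (inj₂ qa) (inj₁ _)  (inj₂ qd) = inj₂ (inj₁ (Q! qa qd))

AtMostTwo-⊆ : {P Q : A → Set} → (∀ {a} → P a → Q a) → AtMostTwo Q → AtMostTwo P
AtMostTwo-⊆ P⊆Q atMostTwo pa pb pd = atMostTwo (P⊆Q pa) (P⊆Q pb) (P⊆Q pd)

AtMostTwo-image : {B : Set} {P : B → Set} (f : B → A) →
                  AtMostTwo P → AtMostTwo (λ a → ∃ λ i → f i ≡ a × P i)
AtMostTwo-image f atMostTwo (_ , refl , pi) (_ , refl , pj) (_ , refl , pk) =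
  Sum.map (cong f) (Sum.map (cong f) (cong f)) (atMostTwo pi pj pk)

CycleEdge-succ-unique : ∀ {m} {i : Fin m} → AtMostOne (CycleEdge m i)
CycleEdge-succ-unique (inj₁ i+1≡j) (inj₁ i+1≡k) = toℕ-injective (trans (sym i+1≡j) i+1≡k)
CycleEdge-succ-unique {a = j} (inj₁ i+1≡j) (inj₂ (i+1≡m , _)) =
  ⊥-elim (<-irrefl (trans (sym i+1≡j) i+1≡m) (toℕ<n j))
CycleEdge-succ-unique {b = k} (inj₂ (i+1≡m , _)) (inj₁ i+1≡k) =
  ⊥-elim (<-irrefl (trans (sym i+1≡k) i+1≡m) (toℕ<n k))
CycleEdge-succ-unique (inj₂ (_ , j≡0)) (inj₂ (_ , k≡0)) = toℕ-injective (trans j≡0 (sym k≡0))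

CycleEdge-pred-unique : ∀ {m} {i : Fin m} → AtMostOne (λ j → CycleEdge m j i)
CycleEdge-pred-unique (inj₁ j+1≡i) (inj₁ k+1≡i) =
  toℕ-injective (suc-injective (trans j+1≡i (sym k+1≡i)))
CycleEdge-pred-unique (inj₁ j+1≡i) (inj₂ (_ , i≡0)) with () ← trans j+1≡i i≡0
CycleEdge-pred-unique (inj₂ (_ , i≡0)) (inj₁ k+1≡i) with () ← trans k+1≡i i≡0
CycleEdge-pred-unique (inj₂ (j+1≡m , _)) (inj₂ (k+1≡m , _)) =
  toℕ-injective (suc-injective (trans j+1≡m (sym k+1≡m)))

module _ (G : Graph) where
  open Graph G renaming (sym to adj-sym)
  open import Data.List.Membership.DecPropositional (_≟_ {n}) using (_∈?_)
  open import Data.List.Relation.Unary.Unique.DecPropositional (_≟_ {n}) using (unique?)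

  private variable
    u v w x y z a b c d : Fin n
    L M : List (Fin n)

  infix 4 _∼_
  _∼_ : Fin n → Fin n → Set
  x ∼ y = T (adj x y)

  ∼-sym : x ∼ y → y ∼ x
  ∼-sym {x} {y} = subst T (adj-sym x y)

  ∼⇒≢ : x ∼ y → x ≢ y
  ∼⇒≢ {x} x∼x refl = subst T (irrefl x) x∼x

  Chain⇒∼ : Chain G L → Consec G x y L → x ∼ y
  Chain⇒∼ (x∼y , _) here                          = x∼y
  Chain⇒∼ {L = _ ∷ _ ∷ _} (_ , chain) (there xy) = Chain⇒∼ chain xy

  ∼⇒Chain : (∀ {x y} → Consec G x y L → x ∼ y) → Chain G L
  ∼⇒Chain {[]}        _         = tt
  ∼⇒Chain {_ ∷ []}    _         = tt
  ∼⇒Chain {_ ∷ _ ∷ _} adjacent = adjacent here , ∼⇒Chain (adjacent ∘ there)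

  Consec⇒∈ˡ : Consec G x y L → x ∈ L
  Consec⇒∈ˡ here       = here refl
  Consec⇒∈ˡ (there xy) = there (Consec⇒∈ˡ xy)

  Consec⇒∈ʳ : Consec G x y L → y ∈ L
  Consec⇒∈ʳ here       = there (here refl)
  Consec⇒∈ʳ (there xy) = there (Consec⇒∈ʳ xy)

  Consec-++⁺ʳ : ∀ M → Consec G x y L → Consec G x y (M ++ L)
  Consec-++⁺ʳ []      xy = xy
  Consec-++⁺ʳ (_ ∷ M) xy = there (Consec-++⁺ʳ M xy)

  Consec-++⁺ˡ : Consec G x y L → Consec G x y (L ++ M)
  Consec-++⁺ˡ here       = here
  Consec-++⁺ˡ (there xy) = there (Consec-++⁺ˡ xy)

  Consec-junction : ∀ L → last L ≡ just x → head M ≡ just y → Consec G x y (L ++ M)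
  Consec-junction {M = _ ∷ _} (_ ∷ [])    refl refl = here
  Consec-junction             (_ ∷ z ∷ L) lst  hd   = there (Consec-junction (z ∷ L) lst hd)

  Consec-++⁻ : ∀ L → Consec G x y (L ++ M) →
               Consec G x y L ⊎ Consec G x y M ⊎ (last L ≡ just x × head M ≡ just y)
  Consec-++⁻ []          xy         = inj₂ (inj₁ xy)
  Consec-++⁻ (_ ∷ [])    here       = inj₂ (inj₂ (refl , refl))
  Consec-++⁻ (_ ∷ [])    (there xy) = inj₂ (inj₁ xy)
  Consec-++⁻ (_ ∷ _ ∷ L) here       = inj₁ here
  Consec-++⁻ (_ ∷ z ∷ L) (there xy) = Sum.map₁ there (Consec-++⁻ (z ∷ L) xy)

  Consec⇒∃++ : Consec G x y L → ∃₂ λ L₁ L₂ → L ≡ L₁ ++ x ∷ y ∷ L₂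
  Consec⇒∃++ (here {L₂})    = [] , L₂ , refl
  Consec⇒∃++ (there {z} xy) with L₁ , L₂ , refl ← Consec⇒∃++ xy = z ∷ L₁ , L₂ , refl

  Consec-reverse : Consec G x y L → Consec G y x (reverse L)
  Consec-reverse {x} {y} xy with L₁ , L₂ , refl ← Consec⇒∃++ xy =
    subst (Consec G y x) (sym (reverse-++-∷-∷ L₁ x y L₂)) (Consec-++⁺ʳ (reverse L₂) here)

  Consec-reverse⁻ : Consec G x y (reverse L) → Consec G y x L
  Consec-reverse⁻ {L = L} xy = subst (Consec G _ _) (reverse-involutive L) (Consec-reverse xy)

  Consec-∷-reverse : ∀ L → Consec G y z (x ∷ reverse L) → Consec G z y (L ++ x ∷ M)
  Consec-∷-reverse {x = x} {M} L yz = subst (Consec G _ _) (++-assoc L [ x ] M)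
    (Consec-++⁺ˡ (Consec-reverse⁻ {L = L ∷ʳ x} (subst (Consec G _ _) (∷-reverse L x) yz)))

  Consec-succ-unique : Unique L → AtMostOne (λ y → Consec G x y L)
  Consec-succ-unique _          here       here       = refl
  Consec-succ-unique uniq       here       (there xb) = ⊥-elim (Unique[x∷xs]⇒x∉xs uniq (Consec⇒∈ˡ xb))
  Consec-succ-unique uniq       (there xa) here       = ⊥-elim (Unique[x∷xs]⇒x∉xs uniq (Consec⇒∈ˡ xa))
  Consec-succ-unique (_ ∷ uniq) (there xa) (there xb) = Consec-succ-unique uniq xa xb

  ¬Consec-into-head : Unique (y ∷ L) → ¬ Consec G x y (y ∷ L)
  ¬Consec-into-head uniq here       = Unique[x∷xs]⇒x∉xs uniq (here refl)
  ¬Consec-into-head uniq (there xy) = Unique[x∷xs]⇒x∉xs uniq (Consec⇒∈ʳ xy)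

  Consec-pred-unique : Unique L → AtMostOne (λ x → Consec G x y L)
  Consec-pred-unique _          here       here       = refl
  Consec-pred-unique (_ ∷ uniq) here       (there by) = ⊥-elim (¬Consec-into-head uniq by)
  Consec-pred-unique (_ ∷ uniq) (there ay) here       = ⊥-elim (¬Consec-into-head uniq ay)
  Consec-pred-unique (_ ∷ uniq) (there ay) (there by) = Consec-pred-unique uniq ay by

  Consec⇒lookup : Consec G a b L →
                  ∃₂ λ i j → lookup L i ≡ a × lookup L j ≡ b × suc (toℕ i) ≡ toℕ j
  Consec⇒lookup here       = zero , suc zero , refl , refl , refl
  Consec⇒lookup (there ab) with i , j , eqi , eqj , eq ← Consec⇒lookup ab =
    suc i , suc j , eqi , eqj , cong suc eq

  lookup⇒Consec : ∀ L {i j} → suc (toℕ i) ≡ toℕ j → Consec G (lookup L i) (lookup L j) L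
  lookup⇒Consec (_ ∷ _ ∷ _) {zero}  {suc zero} _  = here
  lookup⇒Consec (_ ∷ L)     {suc i} {suc j}    eq = there (lookup⇒Consec L (suc-injective eq))

  Chain-reverse : Chain G L → Chain G (reverse L)
  Chain-reverse chain = ∼⇒Chain (λ xy → ∼-sym (Chain⇒∼ chain (Consec-reverse⁻ xy)))

  IsPath-reverse : IsPath G u v L → IsPath G v u (reverse L)
  IsPath-reverse {L = L} (hd , lst , uniq , chain) =
    trans (head-reverse L) lst , trans (last-reverse L) hd , Unique-reverse uniq , Chain-reverse chain

  EdgeOf-reverse : EdgeOf G x y L → EdgeOf G x y (reverse L)
  EdgeOf-reverse (inj₁ xy) = inj₂ (Consec-reverse xy)
  EdgeOf-reverse (inj₂ yx) = inj₁ (Consec-reverse yx)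

  IsPath⇒∼ : IsPath G u v L → EdgeOf G x y L → x ∼ y
  IsPath⇒∼ (_ , _ , _ , chain) (inj₁ xy) = Chain⇒∼ chain xy
  IsPath⇒∼ (_ , _ , _ , chain) (inj₂ yx) = ∼-sym (Chain⇒∼ chain yx)

  EdgeInF⇒∼ : EdgeInF G u v x y → x ∼ y
  EdgeInF⇒∼ (_ , path , xy) = IsPath⇒∼ path xy

  Chain-closed : (S : Fin n → Set) → (∀ {a b} → S a → a ∼ b → S b) →
                 Chain G (a ∷ L) → S a → last (a ∷ L) ≡ just b → S b
  Chain-closed {L = []}    S closed _              Sa refl = Sa
  Chain-closed {L = _ ∷ L} S closed (a∼a′ , chain) Sa lst  =
    Chain-closed S closed chain (closed Sa a∼a′) lst

  Connected⇒closed⇒all : Connected G → (S : Fin n → Set) → (∀ {a b} → S a → a ∼ b → S b) →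
                         S a → ∀ b → S b
  Connected⇒closed⇒all {a} (_ , connected) S closed Sa b
    with _ ∷ L , refl , lst , _ , chain ← connected a b = Chain-closed S closed chain Sa lst

  -- No choke point implies the pairwise edge-disjoint path property

  threeNeighbours⇒ChokePoint : a ≢ b → a ≢ d → b ≢ d →
    EdgeInF G u v c a → EdgeInF G u v c b → EdgeInF G u v c d → ChokePointOf G u v c
  threeNeighbours⇒ChokePoint {a} {b} {d} {u} {v} {c} a≢b a≢d b≢d ca cb cd =
    3 , ≤-refl , lookup leaves , lookup-injective distinct ,
    (λ i → ≢-sym (∼⇒≢ (EdgeInF⇒∼ (edge i)))) , edge
    where
    leaves : List (Fin n)
    leaves = a ∷ b ∷ d ∷ []
    distinct : Unique leaves
    distinct = (a≢b ∷ a≢d ∷ []) ∷ (b≢d ∷ []) ∷ [] ∷ []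
    edge : ∀ i → EdgeInF G u v c (lookup leaves i)
    edge i = All.lookup {P = EdgeInF G u v c} (ca ∷ cb ∷ cd ∷ []) (∈-lookup i)

  ChokePointOf⇒¬AtMostTwo : ChokePointOf G u v c → ¬ AtMostTwo (EdgeInF G u v c)
  ChokePointOf⇒¬AtMostTwo (_ , s≤s (s≤s (s≤s _)) , _ , injective , _ , edge) atMostTwo
    with atMostTwo (edge zero) (edge (suc zero)) (edge (suc (suc zero)))
  ... | inj₁ e        = contradiction (injective e) λ ()
  ... | inj₂ (inj₁ e) = contradiction (injective e) λ ()
  ... | inj₂ (inj₂ e) = contradiction (injective e) λ ()

  -- The walk along a shared edge may follow one of the two paths backwards.
  Joins : Fin n → Fin n → List (Fin n) → Set
  Joins u v L = IsPath G u v L ⊎ IsPath G v u L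

  Joins-reverse : Joins u v L → Joins u v (reverse L)
  Joins-reverse (inj₁ path) = inj₂ (IsPath-reverse path)
  Joins-reverse (inj₂ path) = inj₁ (IsPath-reverse path)

  Joins⇒Unique : Joins u v L → Unique L
  Joins⇒Unique (inj₁ (_ , _ , uniq , _)) = uniq
  Joins⇒Unique (inj₂ (_ , _ , uniq , _)) = uniq

  Joins⇒EdgeInF : Joins u v L → EdgeOf G x y L → EdgeInF G u v x y
  Joins⇒EdgeInF {L = L} (inj₁ path) xy = L , path , xy
  Joins⇒EdgeInF {L = L} (inj₂ path) xy = reverse L , IsPath-reverse path , EdgeOf-reverse xy

  Joins-endpoints : Joins u v L → Joins u v M → last L ≡ just c → head M ≡ just c ⊎ last M ≡ just c
  Joins-endpoints (inj₁ (_ , lL , _)) (inj₁ (_ , lM , _)) eq = inj₂ (trans lM (trans (sym lL) eq))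
  Joins-endpoints (inj₁ (_ , lL , _)) (inj₂ (hM , _))     eq = inj₁ (trans hM (trans (sym lL) eq))
  Joins-endpoints (inj₂ (_ , lL , _)) (inj₁ (hM , _))     eq = inj₁ (trans hM (trans (sym lL) eq))
  Joins-endpoints (inj₂ (_ , lL , _)) (inj₂ (_ , lM , _)) eq = inj₂ (trans lM (trans (sym lL) eq))

  ¬interior-endpoint : ∀ L → Unique (L ++ z ∷ c ∷ a ∷ M) →
    ¬ (head (L ++ z ∷ c ∷ a ∷ M) ≡ just c ⊎ last (L ++ z ∷ c ∷ a ∷ M) ≡ just c)
  ¬interior-endpoint []      uniq (inj₁ eq) = Unique[x∷xs]⇒x∉xs uniq (here (just-injective eq))
  ¬interior-endpoint (_ ∷ L) uniq (inj₁ eq) =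
    Unique[x∷xs]⇒x∉xs uniq (subst (_∈ _) (sym (just-injective eq)) (∈-++⁺ʳ L (there (here refl))))
  ¬interior-endpoint {z = z} L uniq (inj₂ eq) with _ ∷ uniq′ ← Unique-++⁻ʳ L uniq =
    Unique[x∷xs]⇒x∉xs uniq′ (last⇒∈ (trans (sym (last-++-∷ L z _)) eq))

  -- Follow the common arc z c until the continuations differ; the walk cannot stop early,
  -- since an endpoint of one path is never an interior vertex of the other.
  divergence⇒ChokePoint : ∀ L₁ L₂ R₁ R₂ →
    Joins u v (L₁ ++ z ∷ c ∷ R₁) → Joins u v (L₂ ++ z ∷ c ∷ R₂) → R₁ ≢ R₂ → HasChokePoint G
  divergence⇒ChokePoint L₁ L₂ [] [] _ _ R₁≢R₂ = ⊥-elim (R₁≢R₂ refl)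
  divergence⇒ChokePoint {z = z} L₁ L₂ [] (_ ∷ _) j₁ j₂ _ =
    ⊥-elim (¬interior-endpoint L₂ (Joins⇒Unique j₂) (Joins-endpoints j₁ j₂ (last-++-∷ L₁ z _)))
  divergence⇒ChokePoint {z = z} L₁ L₂ (_ ∷ _) [] j₁ j₂ _ =
    ⊥-elim (¬interior-endpoint L₁ (Joins⇒Unique j₁) (Joins-endpoints j₂ j₁ (last-++-∷ L₂ z _)))
  divergence⇒ChokePoint {u} {v} {z} {c} L₁ L₂ (a ∷ R₁) (b ∷ R₂) j₁ j₂ R₁≢R₂ with a ≟ b
  ... | yes refl =
    divergence⇒ChokePoint (L₁ ∷ʳ z) (L₂ ∷ʳ z) R₁ R₂
      (subst (Joins u v) (sym (++-assoc L₁ [ z ] _)) j₁)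
      (subst (Joins u v) (sym (++-assoc L₂ [ z ] _)) j₂)
      (R₁≢R₂ ∘ cong (a ∷_))
  ... | no a≢b
    with (_ ∷ z≢a ∷ _) ∷ _ ← Unique-++⁻ʳ L₁ (Joins⇒Unique j₁)
       | (_ ∷ z≢b ∷ _) ∷ _ ← Unique-++⁻ʳ L₂ (Joins⇒Unique j₂) =
    u , v , c , threeNeighbours⇒ChokePoint z≢a z≢b a≢b
      (Joins⇒EdgeInF j₁ (inj₂ (Consec-++⁺ʳ L₁ here)))
      (Joins⇒EdgeInF j₁ (inj₁ (Consec-++⁺ʳ L₁ (there here))))
      (Joins⇒EdgeInF j₂ (inj₁ (Consec-++⁺ʳ L₂ (there here))))

  sharedArc⇒ChokePoint : Joins u v L → Joins u v M → L ≢ M →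
                         Consec G x y L → Consec G x y M → HasChokePoint G
  sharedArc⇒ChokePoint {u} {v} {x = x} {y} jL jM L≢M xy∈L xy∈M
    with L₁ , R₁ , refl ← Consec⇒∃++ xy∈L | L₂ , R₂ , refl ← Consec⇒∃++ xy∈M
       | ≡-dec _≟_ R₁ R₂
  ... | no R₁≢R₂ = divergence⇒ChokePoint L₁ L₂ R₁ R₂ jL jM R₁≢R₂
  ... | yes refl =
    divergence⇒ChokePoint (reverse R₁) (reverse R₁) (reverse L₁) (reverse L₂)
      (subst (Joins u v) (reverse-++-∷-∷ L₁ x y R₁) (Joins-reverse jL))
      (subst (Joins u v) (reverse-++-∷-∷ L₂ x y R₁) (Joins-reverse jM))
      (λ eq → L≢M (cong (_++ x ∷ y ∷ R₁) (reverse-injective eq)))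

  path≢reverse : u ≢ v → IsPath G u v L → IsPath G u v M → L ≢ reverse M
  path≢reverse {M = M} u≢v (hd , _) (_ , lst , _) refl =
    u≢v (just-injective (trans (sym hd) (trans (head-reverse M) lst)))

  -- An edge traversed by L and M in opposite directions is traversed by L and reverse M in
  -- the same direction, and L ≢ reverse M because u ≢ v.
  sharedEdge⇒ChokePoint : u ≢ v → IsPath G u v L → IsPath G u v M → L ≢ M →
                          EdgeOf G x y L → EdgeOf G x y M → HasChokePoint G
  sharedEdge⇒ChokePoint _ pL pM L≢M (inj₁ xy) (inj₁ xy′) =
    sharedArc⇒ChokePoint (inj₁ pL) (inj₁ pM) L≢M xy xy′
  sharedEdge⇒ChokePoint _ pL pM L≢M (inj₂ yx) (inj₂ yx′) =
    sharedArc⇒ChokePoint (inj₁ pL) (inj₁ pM) L≢M yx yx′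
  sharedEdge⇒ChokePoint u≢v pL pM _ (inj₁ xy) (inj₂ yx) =
    sharedArc⇒ChokePoint (inj₁ pL) (inj₂ (IsPath-reverse pM)) (path≢reverse u≢v pL pM)
      xy (Consec-reverse yx)
  sharedEdge⇒ChokePoint u≢v pL pM _ (inj₂ yx) (inj₁ xy) =
    sharedArc⇒ChokePoint (inj₁ pL) (inj₂ (IsPath-reverse pM)) (path≢reverse u≢v pL pM)
      yx (Consec-reverse xy)

  noChokePoint⇒PEDP : ¬ HasChokePoint G → PEDP G
  noChokePoint⇒PEDP noChokePoint u v u≢v L M pL pM L≢M x y (xy∈L , xy∈M) =
    noChokePoint (sharedEdge⇒ChokePoint u≢v pL pM L≢M xy∈L xy∈M)

  -- Cycles as vertex lists

  CycleSucc : List (Fin n) → Fin n → Fin n → Set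
  CycleSucc L x y = Consec G x y L ⊎ (last L ≡ just x × head L ≡ just y)

  CycleAdj : List (Fin n) → Fin n → Fin n → Set
  CycleAdj L x y = CycleSucc L x y ⊎ CycleSucc L y x

  IsCycleList : List (Fin n) → Set
  IsCycleList L = Unique L × 3 ≤ length L × (∀ {x y} → CycleSucc L x y → x ∼ y)

  IsCycleList⇒HasCycle : IsCycleList L → HasCycle G
  IsCycleList⇒HasCycle {x ∷ y ∷ z ∷ L} (uniq , s≤s (s≤s (s≤s _)) , adjacent)
    with w , lst ← last-∷ z L =
    x , y , z , L , uniq , ∼⇒Chain (adjacent ∘ inj₁) , w , lst , adjacent (inj₂ (lst , refl))

  HasCycle⇒IsCycleList : HasCycle G → ∃ IsCycleList
  HasCycle⇒IsCycleList (x , y , z , L , uniq , chain , w , lst , w∼x) =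
    x ∷ y ∷ z ∷ L , uniq , s≤s (s≤s (s≤s z≤n)) , adjacent
    where
    adjacent : CycleSucc (x ∷ y ∷ z ∷ L) a b → a ∼ b
    adjacent (inj₁ ab)            = Chain⇒∼ chain ab
    adjacent (inj₂ (lst′ , refl)) = subst (_∼ x) (just-injective (trans (sym lst) lst′)) w∼x

  CycleSucc⇒∈ : CycleSucc L a b → a ∈ L × b ∈ L
  CycleSucc⇒∈ (inj₁ ab)         = Consec⇒∈ˡ ab , Consec⇒∈ʳ ab
  CycleSucc⇒∈ (inj₂ (lst , hd)) = last⇒∈ lst , head⇒∈ hd

  CycleAdj⇒∈ʳ : CycleAdj L a b → b ∈ L
  CycleAdj⇒∈ʳ (inj₁ ab) = proj₂ (CycleSucc⇒∈ ab)
  CycleAdj⇒∈ʳ (inj₂ ba) = proj₁ (CycleSucc⇒∈ ba)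

  rotate-CycleSucc : ∀ L M → CycleSucc (c ∷ M ++ x ∷ L) a b → CycleSucc (x ∷ L ++ c ∷ M) a b
  rotate-CycleSucc {c} {x} L M (inj₁ ab) with Consec-++⁻ (c ∷ M) ab
  ... | inj₁ ab∈cM               = inj₁ (Consec-++⁺ʳ (x ∷ L) ab∈cM)
  ... | inj₂ (inj₁ ab∈xL)        = inj₁ (Consec-++⁺ˡ ab∈xL)
  ... | inj₂ (inj₂ (lst , refl)) = inj₂ (trans (last-++-∷ (x ∷ L) c M) lst , refl)
  rotate-CycleSucc {c} {x} L M (inj₂ (lst , refl)) =
    inj₁ (Consec-junction (x ∷ L) (trans (sym (last-++-∷ (c ∷ M) x L)) lst) refl)

  rotate-IsCycleList : ∀ L M → IsCycleList (x ∷ L ++ c ∷ M) → IsCycleList (c ∷ M ++ x ∷ L)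
  rotate-IsCycleList {x} {c} L M (uniq , len , adjacent) =
    Unique-++-comm (x ∷ L) uniq , subst (3 ≤_) (↭-length (++-comm (x ∷ L) (c ∷ M))) len ,
    adjacent ∘ rotate-CycleSucc L M

  CycleSucc-lookup : Unique L → ∀ i j → CycleSucc L (lookup L i) (lookup L j) ⇔ CycleEdge (length L) i j
  CycleSucc-lookup {L} uniq i j = mk⇔ to from
    where
    to : CycleSucc L (lookup L i) (lookup L j) → CycleEdge (length L) i j
    to (inj₁ consec)
      with i′ , j′ , eqi , eqj , eq ← Consec⇒lookup consec
      with refl ← lookup-injective uniq {i′} {i} eqi | refl ← lookup-injective uniq {j′} {j} eqj = inj₁ eq
    to (inj₂ (lst , hd))
      with k , eqk , len ← last⇒lookup {xs = L} lst
      with refl ← lookup-injective uniq {k} {i} eqk = inj₂ (len , head⇒lookup uniq {j} hd)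
    from : CycleEdge (length L) i j → CycleSucc L (lookup L i) (lookup L j)
    from (inj₁ eq)          = inj₁ (lookup⇒Consec L eq)
    from (inj₂ (len , j≡0)) = inj₂ (lookup⇒last L len , lookup⇒head L j≡0)

  CycleAdj-lookup : Unique L → ∀ i j → CycleAdj L (lookup L i) (lookup L j) ⇔ CycAdj (length L) i j
  CycleAdj-lookup uniq i j = CycleSucc-lookup uniq i j ⊎-⇔ CycleSucc-lookup uniq j i

  -- Trees and cycles have no choke points

  splitAtFirst∈ : ∀ L → w ∈ L → w ∈ M →
                  ∃₂ λ L₁ L₂ → ∃ λ x → L ≡ L₁ ++ x ∷ L₂ × x ∈ M × All (_∉ M) L₁
  splitAtFirst∈ {M = M} (x ∷ L) w∈ w∈M with x ∈? M | w∈
  ... | yes x∈M | _         = [] , L , x , refl , x∈M , []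
  ... | no x∉M  | here refl = ⊥-elim (x∉M w∈M)
  ... | no x∉M  | there w∈L
      with L₁ , L₂ , y , refl , y∈M , L₁∉M ← splitAtFirst∈ L w∈L w∈M =
      x ∷ L₁ , L₂ , y , refl , y∈M , x∉M ∷ L₁∉M

  -- The cycle runs from c along L to its first vertex x on M, then back along M to c.
  branch⇒IsCycleList : Unique (c ∷ L) → Unique (c ∷ M) → Chain G (c ∷ L) → Chain G (c ∷ M) →
                       w ∈ L → w ∈ M → head L ≢ head M → ∃ IsCycleList
  branch⇒IsCycleList {c} {L} {M} uniqL@(_ ∷ uniqL′) uniqM@(_ ∷ uniqM′) chainL chainM w∈L w∈M heads≢
    with s , t , x , refl , x∈M , s∉M ← splitAtFirst∈ L w∈L w∈M
    with r , q , refl ← ∈-∃++ x∈M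
    = c ∷ s ++ back , c∉ ∷ ++⁺ (Unique-++⁻ˡ s uniqL′) (Unique-∷-reverse r uniqM′) disjoint ,
      s≤s (head≢last⇒2≤length head≢last) , adjacent
    where
    back : List (Fin n)
    back = x ∷ reverse r

    head≢last : head (s ++ back) ≢ last (s ++ back)
    head≢last eq = heads≢
      (trans (head-++-∷ s x t _) (trans eq (trans (last-++-∷ s x _) (last-∷-reverse r x q))))

    c∉ : All (c ≢_) (s ++ back)
    c∉ = ¬Any⇒All¬ (s ++ back) λ c∈ → Sum.[ Unique[x∷xs]⇒x∉xs uniqL ∘ ∈-++⁺ˡ
                                          , Unique[x∷xs]⇒x∉xs uniqM ∘ ∈-∷-reverse ] (∈-++⁻ s c∈)

    disjoint : ∀ {y} → ¬ (y ∈ s × y ∈ back)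
    disjoint (y∈s , y∈back) = All.lookup s∉M y∈s (∈-∷-reverse y∈back)

    adjacent : CycleSucc (c ∷ s ++ back) y z → y ∼ z
    adjacent (inj₁ yz) with Consec-++⁻ (c ∷ s) yz
    ... | inj₁ yz∈cs               = Chain⇒∼ chainL (Consec-++⁺ˡ yz∈cs)
    ... | inj₂ (inj₁ yz∈back)      = ∼-sym (Chain⇒∼ chainM (there (Consec-∷-reverse r yz∈back)))
    ... | inj₂ (inj₂ (lst , refl)) = Chain⇒∼ chainL (Consec-junction (c ∷ s) lst refl)
    adjacent (inj₂ (lst , refl)) = ∼-sym (Chain⇒∼ chainM (Consec-junction [ c ] refl
      (trans (sym (last-∷-reverse r x q)) (trans (sym (last-++-∷ (c ∷ s) x _)) lst))))

  distinctTails⇒IsCycleList : ∀ c L M → Unique (c ∷ L) → Unique (c ∷ M) → Chain G (c ∷ L) →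
    Chain G (c ∷ M) → last (c ∷ L) ≡ last (c ∷ M) → L ≢ M → ∃ IsCycleList
  distinctTails⇒IsCycleList c [] [] _ _ _ _ _ L≢M = ⊥-elim (L≢M refl)
  distinctTails⇒IsCycleList c [] (_ ∷ M) _ uniqM _ _ lst _ =
    ⊥-elim (Unique[x∷xs]⇒x∉xs uniqM (last⇒∈ (sym lst)))
  distinctTails⇒IsCycleList c (_ ∷ L) [] uniqL _ _ _ lst _ =
    ⊥-elim (Unique[x∷xs]⇒x∉xs uniqL (last⇒∈ lst))
  distinctTails⇒IsCycleList c (a ∷ L) (b ∷ M) uniqL uniqM chainL chainM lst L≢M with a ≟ b
  ... | yes refl = distinctTails⇒IsCycleList a L M (Unique-++⁻ʳ [ c ] uniqL) (Unique-++⁻ʳ [ c ] uniqM)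
                     (proj₂ chainL) (proj₂ chainM) lst (L≢M ∘ cong (a ∷_))
  ... | no a≢b with w , lst′ ← last-∷ a L =
    branch⇒IsCycleList uniqL uniqM chainL chainM (last⇒∈ lst′) (last⇒∈ (trans (sym lst) lst′))
      (a≢b ∘ just-injective)

  distinctPaths⇒IsCycleList : IsPath G u v L → IsPath G u v M → L ≢ M → ∃ IsCycleList
  distinctPaths⇒IsCycleList {L = u ∷ L} {M = u ∷ M}
    (refl , lstL , uniqL , chainL) (refl , lstM , uniqM , chainM) L≢M =
    distinctTails⇒IsCycleList u L M uniqL uniqM chainL chainM (trans lstL (sym lstM)) (L≢M ∘ cong (u ∷_))

  acyclic⇒uniquePath : ¬ HasCycle G → IsPath G u v L → IsPath G u v M → L ≡ M
  acyclic⇒uniquePath acyclic pL pM = decidable-stable (≡-dec _≟_ _ _)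
    (λ L≢M → acyclic (IsCycleList⇒HasCycle (proj₂ (distinctPaths⇒IsCycleList pL pM L≢M))))

  tree⇒noChokePoint : IsTree G → ¬ HasChokePoint G
  tree⇒noChokePoint (_ , acyclic) (u , v , c , chokePoint) = ChokePointOf⇒¬AtMostTwo chokePoint atMostTwo
    where
    atMostTwo : AtMostTwo (EdgeInF G u v c)
    atMostTwo (L , pL@(_ , _ , uniq , _) , ca) (_ , pM , cb) (_ , pN , cd)
      with refl ← acyclic⇒uniquePath acyclic pL pM | refl ← acyclic⇒uniquePath acyclic pL pN =
      atMostTwo-⊎ (Consec-succ-unique uniq) (Consec-pred-unique uniq) ca cb cd

  cycle⇒noChokePoint : IsCycle G → ¬ HasChokePoint G
  cycle⇒noChokePoint (_ , σ , (_ , σ-surjective) , σ-adj) (_ , _ , c , chokePoint) =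
    ChokePointOf⇒¬AtMostTwo chokePoint (AtMostTwo-⊆ (neighbourIndex ∘ EdgeInF⇒∼)
      (AtMostTwo-image σ (atMostTwo-⊎ CycleEdge-succ-unique CycleEdge-pred-unique)))
    where
    i₀ : Fin n
    i₀ = proj₁ (σ-surjective c)
    σi₀≡c : σ i₀ ≡ c
    σi₀≡c = proj₂ (σ-surjective c) refl
    neighbourIndex : c ∼ a → ∃ λ j → σ j ≡ a × CycAdj n i₀ j
    neighbourIndex {a} c∼a with j , σj≡a ← σ-surjective a =
      j , σj≡a refl ,
      Equivalence.to (σ-adj i₀ j) (subst₂ _∼_ (sym σi₀≡c) (sym (σj≡a refl)) c∼a)

  tree⊎cycle⇒noChokePoint : IsTree G ⊎ IsCycle G → ¬ HasChokePoint G
  tree⊎cycle⇒noChokePoint (inj₁ tree)  = tree⇒noChokePoint tree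
  tree⊎cycle⇒noChokePoint (inj₂ cycle) = cycle⇒noChokePoint cycle

  -- A graph with the path property is a tree or a cycle

  -- x c y and x M c y are distinct x–y paths sharing the edge c y.
  PEDP⇒noShortcut : PEDP G → IsPath G x y (x ∷ M ++ c ∷ y ∷ []) → M ≢ [] → ¬ (x ∼ c)
  PEDP⇒noShortcut {x} {y} {M} {c} pedp long@(_ , _ , x∉ ∷ uniq , chain) M≢[] x∼c =
    pedp x y x≢y short (x ∷ M ++ c ∷ y ∷ []) shortPath long short≢long c y
      (inj₁ (there here) , inj₁ (there (Consec-++⁺ʳ M here)))
    where
    short : List (Fin n)
    short = x ∷ c ∷ y ∷ []
    x≢y : x ≢ y
    x≢y = All.lookup x∉ (∈-++⁺ʳ M (there (here refl)))
    c≢y : c ≢ y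
    c≢y with (c≢y ∷ []) ∷ _ ← Unique-++⁻ʳ M uniq = c≢y
    shortPath : IsPath G x y short
    shortPath = refl , refl , (∼⇒≢ x∼c ∷ x≢y ∷ []) ∷ (c≢y ∷ []) ∷ [] ∷ [] ,
                x∼c , Chain⇒∼ chain (there (Consec-++⁺ʳ M here)) , tt
    short≢long : short ≢ x ∷ M ++ c ∷ y ∷ []
    short≢long eq = M≢[] (++-identityˡ-unique M (∷-injectiveʳ eq))

  cycle-detour : IsCycleList (c ∷ L ++ x ∷ M) → y ∉ x ∷ M → c ∼ y →
                 IsPath G x y (x ∷ M ++ c ∷ y ∷ [])
  cycle-detour {c} {L} {x} {M} {y} (c∉ ∷ uniq , _ , adjacent) y∉xM c∼y =
    refl , last-++-∷ (x ∷ M) c (y ∷ []) ,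
    ++⁺ (Unique-++⁻ʳ L uniq) ((∼⇒≢ c∼y ∷ []) ∷ [] ∷ []) disjoint ,
    ∼⇒Chain consecutive
    where
    disjoint : ∀ {z} → ¬ (z ∈ x ∷ M × z ∈ c ∷ y ∷ [])
    disjoint (c∈xM , here refl)         = All.lookup c∉ (∈-++⁺ʳ L c∈xM) refl
    disjoint (y∈xM , there (here refl)) = y∉xM y∈xM
    consecutive : Consec G a b (x ∷ M ++ c ∷ y ∷ []) → a ∼ b
    consecutive ab with Consec-++⁻ (x ∷ M) ab
    ... | inj₁ ab∈xM                     = adjacent (inj₁ (there (Consec-++⁺ʳ L ab∈xM)))
    ... | inj₂ (inj₁ here)               = c∼y
    ... | inj₂ (inj₁ (there (there ())))
    ... | inj₂ (inj₂ (lst , refl))       = adjacent (inj₂ (trans (last-++-∷ (c ∷ L) x M) lst , refl))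

  PEDP⇒¬offCycleNeighbour : PEDP G → IsCycleList (c ∷ L) → w ∉ L → ¬ (c ∼ w)
  PEDP⇒¬offCycleNeighbour {L = d ∷ e ∷ L} pedp cycle@(_ , s≤s (s≤s (s≤s _)) , adjacent) w∉L c∼w =
    PEDP⇒noShortcut {M = e ∷ L} pedp (cycle-detour {L = []} cycle w∉L c∼w) (λ ())
      (∼-sym (adjacent (inj₁ here)))

  PEDP⇒¬chord : PEDP G → IsCycleList (c ∷ d ∷ L ++ w ∷ x ∷ M) → ¬ (c ∼ w)
  PEDP⇒¬chord {d = d} {L} {w} {x} {M} pedp cycle@(_ ∷ uniq , _ , adjacent) c∼w =
    PEDP⇒noShortcut {M = x ∷ M} pedp (cycle-detour {L = d ∷ L} cycle d∉wxM (adjacent (inj₁ here)))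
      (λ ()) (∼-sym c∼w)
    where
    d∉wxM : d ∉ w ∷ x ∷ M
    d∉wxM = Unique-++-disjoint (d ∷ L) uniq (here refl)

  PEDP⇒headNeighbour : PEDP G → IsCycleList (c ∷ L) → c ∼ w → CycleAdj (c ∷ L) c w
  PEDP⇒headNeighbour {c} {L} {w} pedp cycle c∼w with w ∈? L
  ... | no w∉L = ⊥-elim (PEDP⇒¬offCycleNeighbour pedp cycle w∉L c∼w)
  ... | yes w∈L with ∈-∃++ w∈L
  ...   | [] , _ , refl        = inj₁ (inj₁ here)
  ...   | d ∷ s , [] , refl    = inj₂ (inj₂ (last-++-∷ (c ∷ d ∷ s) w [] , refl))
  ...   | _ ∷ _ , _ ∷ _ , refl = ⊥-elim (PEDP⇒¬chord pedp cycle c∼w)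

  PEDP⇒cycleNeighbour : PEDP G → IsCycleList L → c ∈ L → c ∼ w → CycleAdj L c w
  PEDP⇒cycleNeighbour pedp cycle c∈L c∼w with ∈-∃++ c∈L
  ... | [] , _ , refl    = PEDP⇒headNeighbour pedp cycle c∼w
  ... | _ ∷ L , M , refl =
    Sum.map (rotate-CycleSucc L M) (rotate-CycleSucc L M)
      (PEDP⇒headNeighbour pedp (rotate-IsCycleList L M cycle) c∼w)

  PEDP⇒∼⇔CycleAdj : PEDP G → IsCycleList L → a ∈ L → (a ∼ b) ⇔ CycleAdj L a b
  PEDP⇒∼⇔CycleAdj pedp cycle@(_ , _ , adjacent) a∈L =
    mk⇔ (PEDP⇒cycleNeighbour pedp cycle a∈L)
        λ { (inj₁ ab) → adjacent ab ; (inj₂ ba) → ∼-sym (adjacent ba) }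

  PEDP⇒cycleCovers : Connected G → PEDP G → IsCycleList L → ∀ w → w ∈ L
  PEDP⇒cycleCovers {x ∷ L} connected pedp cycle = Connected⇒closed⇒all connected (_∈ x ∷ L)
    (λ a∈ a∼b → CycleAdj⇒∈ʳ (PEDP⇒cycleNeighbour pedp cycle a∈ a∼b)) (here refl)

  -- IsCycle G with Fin m as index set, so that σ = lookup L fits before length L ≡ n is known.
  CycleOfLength : ℕ → Set
  CycleOfLength m = 3 ≤ m × Σ (Fin m → Fin n) λ σ →
    Bijective _≡_ _≡_ σ × (∀ i j → (σ i ∼ σ j) ⇔ CycAdj m i j)

  PEDP⇒IsCycle : Connected G → PEDP G → IsCycleList L → IsCycle G
  PEDP⇒IsCycle {L} connected pedp cycle@(uniq , len , _) =
    subst CycleOfLength (↔⇒≡ (⤖⇒↔ (mk⤖ bijective))) (len , lookup L , bijective , adjacency)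
    where
    covers : ∀ w → w ∈ L
    covers = PEDP⇒cycleCovers connected pedp cycle
    bijective : Bijective _≡_ _≡_ (lookup L)
    bijective = lookup-injective uniq , λ w → index (covers w) , λ { refl → sym (lookup-index (covers w)) }
    adjacency : ∀ i j → (lookup L i ∼ lookup L j) ⇔ CycAdj (length L) i j
    adjacency i j = CycleAdj-lookup uniq i j ⇔-∘ PEDP⇒∼⇔CycleAdj pedp cycle (∈-lookup i)

  Chain? : ∀ L → Dec (Chain G L)
  Chain? []          = yes tt
  Chain? (_ ∷ [])    = yes tt
  Chain? (x ∷ y ∷ L) = T? (adj x y) ×-dec Chain? (y ∷ L)

  CycleOn : List (Fin n) → Set
  CycleOn (x ∷ y ∷ z ∷ L) =
    Unique (x ∷ y ∷ z ∷ L) × Chain G (x ∷ y ∷ z ∷ L) × ∃ λ w → last (z ∷ L) ≡ just w × w ∼ x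
  CycleOn _               = ⊥

  CycleOn? : ∀ L → Dec (CycleOn L)
  CycleOn? []              = no λ ()
  CycleOn? (_ ∷ [])        = no λ ()
  CycleOn? (_ ∷ _ ∷ [])    = no λ ()
  CycleOn? (x ∷ y ∷ z ∷ L) =
    unique? _ ×-dec Chain? _ ×-dec any? λ w → Maybe.≡-dec _≟_ (last (z ∷ L)) (just w) ×-dec T? (adj w x)

  HasCycle? : Dec (HasCycle G)
  HasCycle? = map′ fromList toList (∃≤? CycleOn CycleOn? n)
    where
    fromList : ∃≤ n CycleOn → HasCycle G
    fromList (x ∷ y ∷ z ∷ L , _ , cycle) = x , y , z , L , cycle
    toList : HasCycle G → ∃≤ n CycleOn
    toList (x , y , z , L , cycle@(uniq , _)) =
      x ∷ y ∷ z ∷ L , injective⇒≤ (lookup-injective uniq) , cycle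

  PEDP⇒tree⊎cycle : Connected G → PEDP G → IsTree G ⊎ IsCycle G
  PEDP⇒tree⊎cycle connected pedp with HasCycle?
  ... | no acyclic   = inj₁ (connected , acyclic)
  ... | yes hasCycle = inj₂ (PEDP⇒IsCycle connected pedp (proj₂ (HasCycle⇒IsCycleList hasCycle)))

theorem4p6 : (G : Graph) → Connected G →
    ((¬ HasChokePoint G) ⇔ PEDP G) × (PEDP G ⇔ (IsTree G ⊎ IsCycle G))
theorem4p6 G connected =
  mk⇔ (noChokePoint⇒PEDP G) (tree⊎cycle⇒noChokePoint G ∘ PEDP⇒tree⊎cycle G connected) ,
  mk⇔ (PEDP⇒tree⊎cycle G connected) (noChokePoint⇒PEDP G ∘ tree⊎cycle⇒noChokePoint G)
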